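{- Let $M \ge 2$, $N\ge1$ be integers with $\operatorname{rad}(M) \nmid \operatorname{rad}(N)$, let $\xi$ be a primitive $M$-th root of unity, and let $p \ge 1$. For every polynomial $P(u,v)$ (with complex coefficients) of total degree at most $p-1$, $$\sum_{n=0}^{M^p-1} P\big(n, \mathcal{B}_{M,N}(n)\big)\, \xi^{\mathcal{B}_{M,N}(n)} = 0.$$
   Context: For integers $M\ge 2$, $N \ge 1$ and $n\ge 0$ with base-$M$ expansion $n=\sum_{i\ge 0} d_i(n) M^i$, $d_i(n)\in\{0,\dots,M-1\}$, the base-shifting map is $\mathcal{B}_{M,N}(n) := \sum_{i\ge 0} d_i(n) N^i$. $\operatorname{rad}(k)$ is the product of the distinct prime factors of $k$. -}

module Defs where

open import Level using (Level; _⊔_)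
open import Data.Nat using (ℕ; zero; suc; _∸_; _<_)
open import Data.Nat as ℕ using ()
open import Data.Nat.DivMod using (_%_; _/_)
open import Data.Nat.Divisibility using (_∣_; _∣?_)
open import Data.Nat.Primality using (Prime; prime?)
open import Data.List using (List; filter; upTo)
open import Data.Nat.ListAction using (product)
open import Data.Product using (_×_)
open import Relation.Nullary using (¬_)
open import Relation.Nullary.Decidable using (_×-dec_)
open import Data.Sum using () renaming (_⊎_ to _⊎'_)
open import Relation.Binary.PropositionalEquality using () renaming (_≡_ to _≡'_)
open import Algebra.Bundles using (CommutativeRing)

rad : ℕ → ℕ
rad k = product (filter (λ q → prime? q ×-dec (q ∣? k)) (upTo (suc k)))

-- Base-shifting with fuel: Bf f M N n = Σ_i d_i(n) N^i where d_i are the base-M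
-- digits of n, provided the fuel f is at least the number of digits (f = n suffices).
Bf : ℕ → ℕ → ℕ → ℕ → ℕ
Bf zero    M       N n = 0
Bf (suc f) zero    N n = 0
Bf (suc f) (suc m) N n = n % suc m ℕ.+ N ℕ.* Bf f (suc m) N (n / suc m)

-- 𝓑_{M,N}(n) (meaningful for M ≥ 2)
B : ℕ → ℕ → ℕ → ℕ
B M N n = Bf n M N n

module RingDefs {c ℓ : Level} (R : CommutativeRing c ℓ) where
  open CommutativeRing R

  ι : ℕ → Carrier
  ι zero    = 0#
  ι (suc n) = 1# + ι n

  pow : Carrier → ℕ → Carrier
  pow x zero    = 1#
  pow x (suc k) = x * pow x k

  sumTo : ℕ → (ℕ → Carrier) → Carrier
  sumTo zero    f = 0#
  sumTo (suc n) f = sumTo n f + f n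

  IsIntegralDomain : Set (c ⊔ ℓ)
  IsIntegralDomain = ∀ x y → x * y ≈ 0# → (x ≈ 0#) ⊎' (y ≈ 0#)

  CharZero : Set ℓ
  CharZero = ∀ n → ι n ≈ 0# → n ≡' 0

  IsPrimitiveRoot : ℕ → Carrier → Set ℓ
  IsPrimitiveRoot M ξ = (pow ξ M ≈ 1#) × (∀ k → 0 < k → k < M → ¬ (pow ξ k ≈ 1#))

  -- polynomial of total degree ≤ p-1 with coefficient function coef:
  -- P(u,v) = Σ_{a < p} Σ_{b < p - a} coef a b u^a v^b
  evalPoly : ℕ → (ℕ → ℕ → Carrier) → Carrier → Carrier → Carrier
  evalPoly p coef u v =
    sumTo p (λ a → sumTo (p ∸ a) (λ b → coef a b * (pow u a * pow v b)))

-- Write n < M^(p+1) as n = d + qM with a digit d < M. Then 𝓑(n) = d + N 𝓑(q), so the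
-- sum for (P, ξ, p+1) equals the sum for (Q, ξ^N, p), where
--   Q(u,v) = Σ_{d<M} P(d + Mu, d + Nv) ξ^d.
-- Since Σ_{d<M} ξ^d = 0, the leading part of P contributes nothing to Q, so deg Q < deg P;
-- the induction behind this runs over all weighted averages Σ_d w(d) P(d + Mu, d + Nv) ξ^d,
-- which have degree at most deg P, because multiplying P by u or v multiplies w by d.
-- After p steps the polynomial has degree < 0, i.e. it vanishes.
-- The geometric sums Σ_d (ξ^(N^j))^d used along the way vanish because ξ^(N^j) ≠ 1:
-- otherwise M ∣ N^j, so every prime factor of M divides N and rad M ∣ rad N.
module Submission where

open import Defs
open import Level using (Level; _⊔_)
open import Data.Nat using (ℕ; _≤_; _^_)
open import Data.Nat.Divisibility using (_∣_)
open import Relation.Nullary using (¬_)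
open import Algebra.Bundles using (CommutativeRing)

open import Data.Nat as ℕ
  using (zero; suc; pred; _<_; _≤′_; ≤′-refl; ≤′-step; s≤s; z≤n; NonZero)
import Data.Nat.Properties as ℕₚ
open import Data.Nat.DivMod
open import Data.Nat.Divisibility
  using (_∣?_; ∣-refl; ∣-trans; 1∣_; ∣1⇒≡1; ∣⇒≤; *-pres-∣; n∣m*n; m%n≡0⇒n∣m)
open import Data.Nat.Primality using (Prime; prime?; euclidsLemma; ¬prime[1])
open import Data.Nat.ListAction using (product)
open import Data.Nat.ListAction.Properties using (product-++)
open import Data.List using ([]; [_]; filter; upTo)
open import Data.List.Properties using (upTo-∷ʳ; filter-++; filter-accept; filter-reject)
open import Data.Product using (_×_; _,_)
open import Data.Sum using (inj₁; inj₂)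
open import Data.Empty using (⊥-elim)
open import Function using (_∘_)
open import Relation.Nullary using (Dec; yes; no)
open import Relation.Nullary.Decidable using (_×-dec_)
open import Relation.Unary using (Pred; Decidable)
open import Relation.Binary.PropositionalEquality as ≡ using (_≡_; cong; cong₂; subst; subst₂)

Bf-0 : ∀ f M N → Bf f M N 0 ≡ 0
Bf-0 zero    M       N = ≡.refl
Bf-0 (suc f) zero    N = ≡.refl
Bf-0 (suc f) (suc m) N = ≡.trans (cong (N ℕ.*_) (Bf-0 f (suc m) N)) (ℕₚ.*-zeroʳ N)

m≤1+n⇒m/o≤n : ∀ {M} .{{_ : NonZero M}} → 2 ≤ M → ∀ {n f} → n ≤ suc f → n / M ≤ f
m≤1+n⇒m/o≤n {M} 2≤M {zero}  _         = ℕₚ.≤-trans (ℕₚ.≤-reflexive (0/n≡0 M)) z≤n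
m≤1+n⇒m/o≤n {M} 2≤M {suc n} (s≤s n≤f) = ℕₚ.≤-trans (ℕₚ.<⇒≤pred (m/n<m (suc n) M 2≤M)) n≤f

Bf-fuel : ∀ {M} N → 2 ≤ M → ∀ {f g n} → n ≤ f → n ≤ g → Bf f M N n ≡ Bf g M N n
Bf-fuel {M} N 2≤M {zero}  {g}    z≤n _   = ≡.sym (Bf-0 g M N)
Bf-fuel {M} N 2≤M {suc f} {zero} _   z≤n = Bf-0 (suc f) M N
Bf-fuel {M} N 2≤M@(s≤s (s≤s _)) {suc f} {suc g} {n} n≤f n≤g = cong (λ b → n % M ℕ.+ N ℕ.* b)
  (Bf-fuel N 2≤M (m≤1+n⇒m/o≤n 2≤M n≤f) (m≤1+n⇒m/o≤n 2≤M n≤g))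

B-unfold : ∀ {M} .{{_ : NonZero M}} N → 2 ≤ M → ∀ n → B M N n ≡ n % M ℕ.+ N ℕ.* B M N (n / M)
B-unfold {M} N 2≤M@(s≤s (s≤s _)) n = ≡.trans (Bf-fuel N 2≤M (ℕₚ.≤-refl {n}) (ℕₚ.n≤1+n n))
  (cong (λ b → n % M ℕ.+ N ℕ.* b) (Bf-fuel N 2≤M (m/n≤m n M) ℕₚ.≤-refl))

B-digit : ∀ {M} N → 2 ≤ M → ∀ {d} q → d < M → B M N (d ℕ.+ q ℕ.* M) ≡ d ℕ.+ N ℕ.* B M N q
B-digit {M} N 2≤M@(s≤s (s≤s _)) {d} q d<M = ≡.trans (B-unfold N 2≤M (d ℕ.+ q ℕ.* M))
  (cong₂ (λ r b → r ℕ.+ N ℕ.* B M N b) digit quotient)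
  where
  digit : (d ℕ.+ q ℕ.* M) % M ≡ d
  digit = ≡.trans ([m+kn]%n≡m%n d q M) (m<n⇒m%n≡m d<M)
  quotient : (d ℕ.+ q ℕ.* M) / M ≡ q
  quotient = ≡.trans (+-distrib-/-∣ʳ d (n∣m*n q))
                     (cong₂ ℕ._+_ (m<n⇒m/n≡0 d<M) (m*n/n≡m q M))

-- Radicals

module _ {p} {P : Pred ℕ p} (P? : Decidable P) where

  product-filter-upTo-suc : ∀ L →
    product (filter P? (upTo (suc L))) ≡ product (filter P? (upTo L)) ℕ.* product (filter P? [ L ])
  product-filter-upTo-suc L = ≡.trans (cong (product ∘ filter P?) (≡.sym (upTo-∷ʳ L)))
    (≡.trans (cong product (filter-++ P? (upTo L) [ L ]))
             (product-++ (filter P? (upTo L)) (filter P? [ L ])))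

  product-filter-upTo-+ : ∀ L j → (∀ {i} → L ≤ i → ¬ P i) →
    product (filter P? (upTo (L ℕ.+ j))) ≡ product (filter P? (upTo L))
  product-filter-upTo-+ L zero    _  = cong (product ∘ filter P? ∘ upTo) (ℕₚ.+-identityʳ L)
  product-filter-upTo-+ L (suc j) ¬P
    rewrite ℕₚ.+-suc L j | product-filter-upTo-suc (L ℕ.+ j)
          | filter-reject P? {xs = []} (¬P (ℕₚ.m≤m+n L j))
    = ≡.trans (ℕₚ.*-identityʳ _) (product-filter-upTo-+ L j ¬P)

product-filter-upTo-∣ : ∀ {p q} {P : Pred ℕ p} {Q : Pred ℕ q} →
  (P? : Decidable P) (Q? : Decidable Q) → (∀ {i} → P i → Q i) →
  ∀ L → product (filter P? (upTo L)) ∣ product (filter Q? (upTo L))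
product-filter-upTo-∣ P? Q? P⇒Q zero = ∣-refl
product-filter-upTo-∣ P? Q? P⇒Q (suc L)
  rewrite product-filter-upTo-suc P? L | product-filter-upTo-suc Q? L with P? L
... | yes P[L] rewrite filter-accept Q? {xs = []} (P⇒Q P[L])
  = *-pres-∣ (product-filter-upTo-∣ P? Q? P⇒Q L) ∣-refl
... | no ¬P[L] = *-pres-∣ (product-filter-upTo-∣ P? Q? P⇒Q L) (1∣ _)

primeDivisor? : ∀ K q → Dec (Prime q × q ∣ K)
primeDivisor? K q = prime? q ×-dec (q ∣? K)

rad-upTo : ∀ K .{{_ : NonZero K}} j →
  product (filter (primeDivisor? K) (upTo (suc K ℕ.+ j))) ≡ rad K
rad-upTo K j = product-filter-upTo-+ (primeDivisor? K) (suc K) j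
  (λ K<i (_ , i∣K) → ℕₚ.<⇒≱ K<i (∣⇒≤ i∣K))

rad-∣-rad : ∀ {K K'} .{{_ : NonZero K}} .{{_ : NonZero K'}} →
  (∀ {q} → Prime q → q ∣ K → q ∣ K') → rad K ∣ rad K'
rad-∣-rad {K} {K'} primeDivisors⊆ = subst₂ _∣_ (rad-upTo K K')
  (≡.trans (cong (λ L → product (filter (primeDivisor? K') (upTo (suc L)))) (ℕₚ.+-comm K K'))
           (rad-upTo K' K))
  (product-filter-upTo-∣ (primeDivisor? K) (primeDivisor? K')
    (λ (q-prime , q∣K) → q-prime , primeDivisors⊆ q-prime q∣K) (suc K ℕ.+ K'))

prime∣^⇒∣ : ∀ {q} n j → Prime q → q ∣ n ^ j → q ∣ n
prime∣^⇒∣ n zero    q-prime q∣1 = ⊥-elim (¬prime[1] (subst Prime (∣1⇒≡1 q∣1) q-prime))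
prime∣^⇒∣ n (suc j) q-prime q∣n^[1+j] with euclidsLemma n (n ^ j) q-prime q∣n^[1+j]
... | inj₁ q∣n   = q∣n
... | inj₂ q∣nʲ = prime∣^⇒∣ n j q-prime q∣nʲ

rad∤rad⇒∤^ : ∀ {M N} .{{_ : NonZero M}} .{{_ : NonZero N}} → ¬ rad M ∣ rad N → ∀ j → ¬ M ∣ N ^ j
rad∤rad⇒∤^ rad∤ j M∣Nʲ =
  rad∤ (rad-∣-rad (λ q-prime q∣M → prime∣^⇒∣ _ j q-prime (∣-trans q∣M M∣Nʲ)))

module RingTheory {c ℓ : Level} (R : CommutativeRing c ℓ) where
  open CommutativeRing R hiding (zero)
  open RingDefs R
  open import Relation.Binary.Reasoning.Setoid setoid
  open import Algebra.Solver.Ring.NaturalCoefficients.Default commutativeSemiring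
  open import Algebra.Properties.CommutativeSemigroup +-commutativeSemigroup using (interchange)
  open import Algebra.Properties.CommutativeSemigroup *-commutativeSemigroup using (x∙yz≈y∙xz)
  open import Algebra.Properties.Ring ring using (-1*x≈-x)
  open import Algebra.Properties.Group +-group using (x∙y⁻¹≈ε⇒x≈y; x≈y⇒x∙y⁻¹≈ε; ∙-cancelʳ)
  import Algebra.Properties.Semiring.Exp semiring as Exp
  import Algebra.Properties.Monoid.Mult +-monoid as Mult
  import Algebra.Properties.Semiring.Mult semiring as SemiringMult

  sumTo-cong : ∀ n {f g : ℕ → Carrier} → (∀ {i} → i < n → f i ≈ g i) → sumTo n f ≈ sumTo n g
  sumTo-cong zero    f≈g = refl
  sumTo-cong (suc n) f≈g = +-cong (sumTo-cong n (f≈g ∘ ℕₚ.m<n⇒m<1+n)) (f≈g ℕₚ.≤-refl)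

  sumTo-0 : ∀ n {f : ℕ → Carrier} → (∀ i → f i ≈ 0#) → sumTo n f ≈ 0#
  sumTo-0 zero    f≈0 = refl
  sumTo-0 (suc n) f≈0 = trans (+-cong (sumTo-0 n f≈0) (f≈0 n)) (+-identityʳ 0#)

  sumTo-+ : ∀ n (f g : ℕ → Carrier) → sumTo n (λ i → f i + g i) ≈ sumTo n f + sumTo n g
  sumTo-+ zero    f g = sym (+-identityʳ 0#)
  sumTo-+ (suc n) f g = trans (+-congʳ (sumTo-+ n f g)) (interchange _ _ _ _)

  sumTo-*ˡ : ∀ n a (f : ℕ → Carrier) → sumTo n (λ i → a * f i) ≈ a * sumTo n f
  sumTo-*ˡ zero    a f = sym (zeroʳ a)
  sumTo-*ˡ (suc n) a f = trans (+-congʳ (sumTo-*ˡ n a f)) (sym (distribˡ a _ _))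

  sumTo-*ʳ : ∀ n a (f : ℕ → Carrier) → sumTo n (λ i → f i * a) ≈ sumTo n f * a
  sumTo-*ʳ zero    a f = sym (zeroˡ a)
  sumTo-*ʳ (suc n) a f = trans (+-congʳ (sumTo-*ʳ n a f)) (sym (distribʳ a _ _))

  sumTo-split : ∀ a b (f : ℕ → Carrier) →
    sumTo (a ℕ.+ b) f ≈ sumTo a f + sumTo b (λ i → f (a ℕ.+ i))
  sumTo-split a zero    f rewrite ℕₚ.+-identityʳ a = sym (+-identityʳ _)
  sumTo-split a (suc b) f rewrite ℕₚ.+-suc a b =
    trans (+-congʳ (sumTo-split a b f)) (+-assoc _ _ _)

  sumTo-blocks : ∀ A M (f : ℕ → Carrier) →
    sumTo (A ℕ.* M) f ≈ sumTo A (λ q → sumTo M (λ d → f (d ℕ.+ q ℕ.* M)))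
  sumTo-blocks zero    M f = refl
  sumTo-blocks (suc A) M f rewrite ℕₚ.+-comm M (A ℕ.* M) =
    trans (sumTo-split (A ℕ.* M) M f)
          (+-cong (sumTo-blocks A M f)
                  (sumTo-cong M (λ {d} _ → reflexive (cong f (ℕₚ.+-comm _ d)))))

  ι≡×1# : ∀ n → ι n ≡ n Mult.× 1#
  ι≡×1# zero    = ≡.refl
  ι≡×1# (suc n) = cong (1# +_) (ι≡×1# n)

  ι-+ : ∀ m n → ι (m ℕ.+ n) ≈ ι m + ι n
  ι-+ m n rewrite ι≡×1# (m ℕ.+ n) | ι≡×1# m | ι≡×1# n = Mult.×-homo-+ 1# m n

  ι-* : ∀ m n → ι (m ℕ.* n) ≈ ι m * ι n
  ι-* m n rewrite ι≡×1# (m ℕ.* n) | ι≡×1# m | ι≡×1# n = SemiringMult.×1-homo-* m n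

  pow≡^ : ∀ x n → pow x n ≡ x Exp.^ n
  pow≡^ x zero    = ≡.refl
  pow≡^ x (suc n) = cong (x *_) (pow≡^ x n)

  pow-cong : ∀ n {x y} → x ≈ y → pow x n ≈ pow y n
  pow-cong n {x} {y} rewrite pow≡^ x n | pow≡^ y n = Exp.^-congˡ n

  pow-+ : ∀ x m n → pow x (m ℕ.+ n) ≈ pow x m * pow x n
  pow-+ x m n rewrite pow≡^ x (m ℕ.+ n) | pow≡^ x m | pow≡^ x n = Exp.^-homo-* x m n

  pow-* : ∀ x m n → pow (pow x m) n ≈ pow x (m ℕ.* n)
  pow-* x m n rewrite pow≡^ x m | pow≡^ (x Exp.^ m) n | pow≡^ x (m ℕ.* n) =
    Exp.^-assocʳ x m n

  pow-1# : ∀ n → pow 1# n ≈ 1#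
  pow-1# zero    = refl
  pow-1# (suc n) = trans (*-identityˡ _) (pow-1# n)

  -- Roots of unity

  geometric-sum : ∀ z n → z * sumTo n (pow z) + 1# ≈ sumTo n (pow z) + pow z n
  geometric-sum z zero    = +-congʳ (zeroʳ z)
  geometric-sum z (suc n) = begin
    z * (S + pow z n) + 1#       ≈⟨ shuffle z S (pow z n) ⟩
    (z * S + 1#) + z * pow z n   ≈⟨ +-congʳ (geometric-sum z n) ⟩
    (S + pow z n) + z * pow z n  ∎
    where
    S = sumTo n (pow z)
    shuffle : ∀ z S w → z * (S + w) + 1# ≈ (z * S + 1#) + z * w
    shuffle = solve 3 (λ z S w → z :* (S :+ w) :+ con 1 := (z :* S :+ con 1) :+ z :* w) refl

  sumTo-pow-root : IsIntegralDomain → ∀ {z} n → pow z n ≈ 1# → ¬ z ≈ 1# →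
    sumTo n (pow z) ≈ 0#
  sumTo-pow-root integral {z} n zⁿ≈1 z≉1 with integral (z - 1#) S [z-1]S≈0
    where
    S = sumTo n (pow z)
    zS≈S : z * S ≈ S
    zS≈S = ∙-cancelʳ 1# (z * S) S (trans (geometric-sum z n) (+-congˡ zⁿ≈1))
    [z-1]S≈0 : (z - 1#) * S ≈ 0#
    [z-1]S≈0 = begin
      (z - 1#) * S       ≈⟨ distribʳ S z (- 1#) ⟩
      z * S + - 1# * S   ≈⟨ +-congˡ (-1*x≈-x S) ⟩
      z * S - S          ≈⟨ x≈y⇒x∙y⁻¹≈ε zS≈S ⟩
      0#                 ∎
  ... | inj₁ z-1≈0 = ⊥-elim (z≉1 (x∙y⁻¹≈ε⇒x≈y z 1# z-1≈0))
  ... | inj₂ S≈0   = S≈0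

  pow-root : ∀ {ξ M} → pow ξ M ≈ 1# → ∀ a → pow (pow ξ a) M ≈ 1#
  pow-root {ξ} {M} ξᴹ≈1 a = begin
    pow (pow ξ a) M    ≈⟨ pow-* ξ a M ⟩
    pow ξ (a ℕ.* M)    ≡⟨ cong (pow ξ) (ℕₚ.*-comm a M) ⟩
    pow ξ (M ℕ.* a)    ≈⟨ pow-* ξ M a ⟨
    pow (pow ξ M) a    ≈⟨ trans (pow-cong a ξᴹ≈1) (pow-1# a) ⟩
    1#                 ∎

  primitiveRoot-∣ : ∀ {M ξ} .{{_ : NonZero M}} → IsPrimitiveRoot M ξ →
    ∀ n → pow ξ n ≈ 1# → M ∣ n
  primitiveRoot-∣ {M} {ξ} (ξᴹ≈1 , minimal) n ξⁿ≈1 with n % M ℕₚ.≟ 0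
  ... | yes r≡0 = m%n≡0⇒n∣m n M r≡0
  ... | no  r≢0 = ⊥-elim (minimal (n % M) (ℕₚ.n≢0⇒n>0 r≢0) (m%n<n n M) ξʳ≈1)
    where
    ξʳ≈1 : pow ξ (n % M) ≈ 1#
    ξʳ≈1 = begin
      pow ξ (n % M)                          ≈⟨ *-identityʳ _ ⟨
      pow ξ (n % M) * 1#                     ≈⟨ *-congˡ (pow-root {ξ} {M} ξᴹ≈1 (n / M)) ⟨
      pow ξ (n % M) * pow (pow ξ (n / M)) M  ≈⟨ *-congˡ (pow-* ξ (n / M) M) ⟩
      pow ξ (n % M) * pow ξ (n / M ℕ.* M)    ≈⟨ pow-+ ξ (n % M) _ ⟨
      pow ξ (n % M ℕ.+ n / M ℕ.* M)          ≡⟨ cong (pow ξ) (m≡m%n+[m/n]*n n M) ⟨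
      pow ξ n                                ≈⟨ ξⁿ≈1 ⟩
      1#                                     ∎

  primitiveRoot-sumTo-pow-N^ : IsIntegralDomain →
    ∀ {M N ξ} .{{_ : NonZero M}} .{{_ : NonZero N}} → IsPrimitiveRoot M ξ → ¬ rad M ∣ rad N →
    ∀ j → sumTo M (pow (pow ξ (N ^ j))) ≈ 0#
  primitiveRoot-sumTo-pow-N^ integral {M} {N} {ξ} ξ-primitive@(ξᴹ≈1 , _) rad∤ j =
    sumTo-pow-root integral M (pow-root {ξ} {M} ξᴹ≈1 (N ^ j))
      (rad∤rad⇒∤^ rad∤ j ∘ primitiveRoot-∣ ξ-primitive (N ^ j))

  -- Polynomial functions of bounded degree

  Fn : Set c
  Fn = Carrier → Carrier → Carrier

  -- Deg< k f: f is a polynomial function of total degree < k, so Deg< 0 f means f ≈ 0.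
  data Deg< : ℕ → Fn → Set (c ⊔ ℓ) where
    deg-zero  : ∀ {k f} → (∀ u v → f u v ≈ 0#) → Deg< k f
    deg-const : ∀ {k} a → Deg< (suc k) (λ _ _ → a)
    deg-+     : ∀ {k f g} → Deg< k f → Deg< k g → Deg< k (λ u v → f u v + g u v)
    deg-*     : ∀ {k f} a → Deg< k f → Deg< k (λ u v → a * f u v)
    deg-u*    : ∀ {k f} → Deg< k f → Deg< (suc k) (λ u v → u * f u v)
    deg-v*    : ∀ {k f} → Deg< k f → Deg< (suc k) (λ u v → v * f u v)
    deg-≈     : ∀ {k f g} → Deg< k f → (∀ u v → f u v ≈ g u v) → Deg< k g
    deg-suc   : ∀ {k f} → Deg< k f → Deg< (suc k) f

  Deg<0⇒≈0 : ∀ {f} → Deg< 0 f → ∀ u v → f u v ≈ 0#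
  Deg<0⇒≈0 (deg-zero f≈0)  u v = f≈0 u v
  Deg<0⇒≈0 (deg-+ df dg)   u v = trans (+-cong (Deg<0⇒≈0 df u v) (Deg<0⇒≈0 dg u v)) (+-identityʳ 0#)
  Deg<0⇒≈0 (deg-* a df)    u v = trans (*-congˡ (Deg<0⇒≈0 df u v)) (zeroʳ a)
  Deg<0⇒≈0 (deg-≈ df f≈g)  u v = trans (sym (f≈g u v)) (Deg<0⇒≈0 df u v)

  Deg<-cong : ∀ {k f} → Deg< k f → ∀ {u u' v v'} → u ≈ u' → v ≈ v' → f u v ≈ f u' v'
  Deg<-cong (deg-zero f≈0) {u} {u'} {v} {v'} _ _ = trans (f≈0 u v) (sym (f≈0 u' v'))
  Deg<-cong (deg-const a)   _    _    = refl
  Deg<-cong (deg-+ df dg)   u≈u' v≈v' = +-cong (Deg<-cong df u≈u' v≈v') (Deg<-cong dg u≈u' v≈v')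
  Deg<-cong (deg-* a df)    u≈u' v≈v' = *-congˡ (Deg<-cong df u≈u' v≈v')
  Deg<-cong (deg-u* df)     u≈u' v≈v' = *-cong u≈u' (Deg<-cong df u≈u' v≈v')
  Deg<-cong (deg-v* df)     u≈u' v≈v' = *-cong v≈v' (Deg<-cong df u≈u' v≈v')
  Deg<-cong (deg-≈ df f≈g) {u} {u'} {v} {v'} u≈u' v≈v' =
    trans (sym (f≈g u v)) (trans (Deg<-cong df u≈u' v≈v') (f≈g u' v'))
  Deg<-cong (deg-suc df)    u≈u' v≈v' = Deg<-cong df u≈u' v≈v'

  Deg<-≤ : ∀ {k k' f} → k ≤ k' → Deg< k f → Deg< k' f
  Deg<-≤ {f = f} = raise ∘ ℕₚ.≤⇒≤′
    where
    raise : ∀ {k k'} → k ≤′ k' → Deg< k f → Deg< k' f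
    raise ≤′-refl         df = df
    raise (≤′-step k≤k') df = deg-suc (raise k≤k' df)

  Deg<-u*-pred : ∀ k {f} → Deg< (pred k) f → Deg< k (λ u v → u * f u v)
  Deg<-u*-pred zero    df = deg-zero (λ u v → trans (*-congˡ (Deg<0⇒≈0 df u v)) (zeroʳ u))
  Deg<-u*-pred (suc k) df = deg-u* df

  Deg<-v*-pred : ∀ k {f} → Deg< (pred k) f → Deg< k (λ u v → v * f u v)
  Deg<-v*-pred zero    df = deg-zero (λ u v → trans (*-congˡ (Deg<0⇒≈0 df u v)) (zeroʳ v))
  Deg<-v*-pred (suc k) df = deg-v* df

  Deg<-sumTo : ∀ n {k} (F : ℕ → Fn) → (∀ {i} → i < n → Deg< k (F i)) →
    Deg< k (λ u v → sumTo n (λ i → F i u v))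
  Deg<-sumTo zero    F dF = deg-zero (λ _ _ → refl)
  Deg<-sumTo (suc n) F dF = deg-+ (Deg<-sumTo n F (dF ∘ ℕₚ.m<n⇒m<1+n)) (dF ℕₚ.≤-refl)

  Deg<-monomial : ∀ a b → Deg< (suc (a ℕ.+ b)) (λ u v → pow u a * pow v b)
  Deg<-monomial zero    zero    = deg-const (1# * 1#)
  Deg<-monomial zero    (suc b) = deg-≈ (deg-v* (Deg<-monomial zero b)) (λ u v → x∙yz≈y∙xz v 1# (pow v b))
  Deg<-monomial (suc a) b       = deg-≈ (deg-u* (Deg<-monomial a b)) (λ u v → sym (*-assoc u _ _))

  evalPoly-Deg< : ∀ p coef → Deg< p (evalPoly p coef)
  evalPoly-Deg< p coef = Deg<-sumTo p _ (λ {a} a<p → Deg<-sumTo (p ℕ.∸ a) _ (λ {b} b<p-a →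
    deg-* (coef a b) (Deg<-≤ (a+b<p a<p b<p-a) (Deg<-monomial a b))))
    where
    a+b<p : ∀ {a b} → a < p → b < p ℕ.∸ a → a ℕ.+ b < p
    a+b<p {a} a<p b<p-a =
      ℕₚ.≤-trans (ℕₚ.+-monoʳ-< a b<p-a) (ℕₚ.≤-reflexive (ℕₚ.m+[n∸m]≡n (ℕₚ.<⇒≤ a<p)))

  -- Averaging over a digit

  module Average (M : ℕ) (X Y ζ : Carrier) where

    avg : (ℕ → Carrier) → Fn → Fn
    avg w f u v = sumTo M (λ d → w d * f (ι d + X * u) (ι d + Y * v) * pow ζ d)

    avg-cong : ∀ w {f g} → (∀ u v → f u v ≈ g u v) → ∀ u v → avg w f u v ≈ avg w g u v
    avg-cong w f≈g u v = sumTo-cong M (λ _ → *-congʳ (*-congˡ (f≈g _ _)))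

    avg-≈0 : ∀ w {f} → (∀ u v → f u v ≈ 0#) → ∀ u v → avg w f u v ≈ 0#
    avg-≈0 w f≈0 u v =
      sumTo-0 M (λ d → trans (*-congʳ (trans (*-congˡ (f≈0 _ _)) (zeroʳ (w d)))) (zeroˡ _))

    avg-+ : ∀ w f g u v → avg w (λ u v → f u v + g u v) u v ≈ avg w f u v + avg w g u v
    avg-+ w f g u v = trans (sumTo-cong M (λ _ → spread _ _ _ _)) (sumTo-+ M _ _)
      where
      spread : ∀ w F G z → w * (F + G) * z ≈ w * F * z + w * G * z
      spread = solve 4 (λ w F G z → w :* (F :+ G) :* z := w :* F :* z :+ w :* G :* z) refl

    avg-* : ∀ w a f u v → avg w (λ u v → a * f u v) u v ≈ a * avg w f u v
    avg-* w a f u v = trans (sumTo-cong M (λ _ → pull _ _ _ _)) (sumTo-*ˡ M a _)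
      where
      pull : ∀ w a F z → w * (a * F) * z ≈ a * (w * F * z)
      pull = solve 4 (λ w a F z → w :* (a :* F) :* z := a :* (w :* F :* z)) refl

    avg-shift : ∀ w f (ℓ : Fn) c → (∀ d u v → ℓ (ι d + X * u) (ι d + Y * v) ≈ ι d + c * ℓ u v) →
      ∀ u v → avg w (λ u v → ℓ u v * f u v) u v
                ≈ avg (λ d → w d * ι d) f u v + c * (ℓ u v * avg w f u v)
    avg-shift w f ℓ c ℓ-shift u v = begin
      sumTo M (λ d → w d * (ℓ (x d) (y d) * F d) * pow ζ d)
        ≈⟨ sumTo-cong M (λ {d} _ → *-congʳ (*-congˡ (*-congʳ (ℓ-shift d u v)))) ⟩
      sumTo M (λ d → w d * ((ι d + c * ℓ u v) * F d) * pow ζ d)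
        ≈⟨ sumTo-cong M (λ _ → expand _ _ _ _ _ _) ⟩
      sumTo M (λ d → w d * ι d * F d * pow ζ d + c * (ℓ u v * (w d * F d * pow ζ d)))
        ≈⟨ sumTo-+ M _ _ ⟩
      avg (λ d → w d * ι d) f u v + sumTo M (λ d → c * (ℓ u v * (w d * F d * pow ζ d)))
        ≈⟨ +-congˡ (trans (sumTo-*ˡ M c _) (*-congˡ (sumTo-*ˡ M (ℓ u v) _))) ⟩
      avg (λ d → w d * ι d) f u v + c * (ℓ u v * avg w f u v)
        ∎
      where
      x y : ℕ → Carrier
      x d = ι d + X * u
      y d = ι d + Y * v
      F : ℕ → Carrier
      F d = f (x d) (y d)
      expand : ∀ w a c l F z → w * ((a + c * l) * F) * z ≈ w * a * F * z + c * (l * (w * F * z))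
      expand = solve 6 (λ w a c l F z →
        w :* ((a :+ c :* l) :* F) :* z := w :* a :* F :* z :+ c :* (l :* (w :* F :* z))) refl

    avg-Deg< : ∀ {k f} → Deg< k f → ∀ w → Deg< k (avg w f)
    avg-Deg< (deg-zero f≈0) w = deg-zero (avg-≈0 w f≈0)
    avg-Deg< (deg-const a)  w = deg-const _
    avg-Deg< (deg-+ {f = f} {g} df dg) w =
      deg-≈ (deg-+ (avg-Deg< df w) (avg-Deg< dg w)) (λ u v → sym (avg-+ w f g u v))
    avg-Deg< (deg-* {f = f} a df) w = deg-≈ (deg-* a (avg-Deg< df w)) (λ u v → sym (avg-* w a f u v))
    avg-Deg< (deg-u* {f = f} df) w =
      deg-≈ (deg-+ (deg-suc (avg-Deg< df (λ d → w d * ι d))) (deg-* X (deg-u* (avg-Deg< df w))))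
            (λ u v → sym (avg-shift w f (λ u _ → u) X (λ _ _ _ → refl) u v))
    avg-Deg< (deg-v* {f = f} df) w =
      deg-≈ (deg-+ (deg-suc (avg-Deg< df (λ d → w d * ι d))) (deg-* Y (deg-v* (avg-Deg< df w))))
            (λ u v → sym (avg-shift w f (λ _ v → v) Y (λ _ _ _ → refl) u v))
    avg-Deg< (deg-≈ df f≈g) w = deg-≈ (avg-Deg< df w) (avg-cong w f≈g)
    avg-Deg< (deg-suc df)   w = deg-suc (avg-Deg< df w)

    avg₁ : Fn → Fn
    avg₁ = avg (λ _ → 1#)

    avg₁-Deg<-pred : sumTo M (pow ζ) ≈ 0# → ∀ {k f} → Deg< k f → Deg< (pred k) (avg₁ f)
    avg₁-Deg<-pred Σζ≈0 (deg-zero f≈0) = deg-zero (avg-≈0 _ f≈0)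
    avg₁-Deg<-pred Σζ≈0 (deg-const a)  = deg-zero (λ _ _ → begin
      sumTo M (λ d → 1# * a * pow ζ d)  ≈⟨ sumTo-cong M (λ _ → *-congʳ (*-identityˡ a)) ⟩
      sumTo M (λ d → a * pow ζ d)       ≈⟨ sumTo-*ˡ M a (pow ζ) ⟩
      a * sumTo M (pow ζ)               ≈⟨ *-congˡ Σζ≈0 ⟩
      a * 0#                            ≈⟨ zeroʳ a ⟩
      0#                                ∎)
    avg₁-Deg<-pred Σζ≈0 (deg-+ {f = f} {g} df dg) =
      deg-≈ (deg-+ (avg₁-Deg<-pred Σζ≈0 df) (avg₁-Deg<-pred Σζ≈0 dg)) (λ u v → sym (avg-+ _ f g u v))
    avg₁-Deg<-pred Σζ≈0 (deg-* {f = f} a df) =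
      deg-≈ (deg-* a (avg₁-Deg<-pred Σζ≈0 df)) (λ u v → sym (avg-* _ a f u v))
    avg₁-Deg<-pred Σζ≈0 (deg-u* {k} {f} df) =
      deg-≈ (deg-+ (avg-Deg< df (λ d → 1# * ι d)) (deg-* X (Deg<-u*-pred k (avg₁-Deg<-pred Σζ≈0 df))))
            (λ u v → sym (avg-shift _ f (λ u _ → u) X (λ _ _ _ → refl) u v))
    avg₁-Deg<-pred Σζ≈0 (deg-v* {k} {f} df) =
      deg-≈ (deg-+ (avg-Deg< df (λ d → 1# * ι d)) (deg-* Y (Deg<-v*-pred k (avg₁-Deg<-pred Σζ≈0 df))))
            (λ u v → sym (avg-shift _ f (λ _ v → v) Y (λ _ _ _ → refl) u v))
    avg₁-Deg<-pred Σζ≈0 (deg-≈ df f≈g) = deg-≈ (avg₁-Deg<-pred Σζ≈0 df) (avg-cong _ f≈g)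
    avg₁-Deg<-pred Σζ≈0 (deg-suc df)   = Deg<-≤ ℕₚ.pred[n]≤n (avg₁-Deg<-pred Σζ≈0 df)

  module ShiftedSum (M N : ℕ) (2≤M : 2 ≤ M) where

    shiftedSum : ℕ → Carrier → Fn → Carrier
    shiftedSum p ζ f = sumTo (M ^ p) (λ n → f (ι n) (ι (B M N n)) * pow ζ (B M N n))

    shiftedSum-digit : ∀ ζ {k f} → Deg< k f → ∀ q {d} → d < M →
      f (ι (d ℕ.+ q ℕ.* M)) (ι (B M N (d ℕ.+ q ℕ.* M))) * pow ζ (B M N (d ℕ.+ q ℕ.* M))
        ≈ 1# * f (ι d + ι M * ι q) (ι d + ι N * ι (B M N q)) * pow ζ d * pow (pow ζ N) (B M N q)
    shiftedSum-digit ζ {f = f} df q {d} d<M rewrite B-digit N 2≤M q d<M = begin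
      f (ι (d ℕ.+ q ℕ.* M)) (ι (d ℕ.+ N ℕ.* b)) * pow ζ (d ℕ.+ N ℕ.* b)
        ≈⟨ *-cong (Deg<-cong df (trans (ι-+ d _) (+-congˡ (trans (ι-* q M) (*-comm _ _))))
                                (trans (ι-+ d _) (+-congˡ (ι-* N b))))
                  (trans (pow-+ ζ d _) (*-congˡ (sym (pow-* ζ N b)))) ⟩
      f (ι d + ι M * ι q) (ι d + ι N * ι b) * (pow ζ d * pow (pow ζ N) b)
        ≈⟨ regroup _ _ _ ⟩
      1# * f (ι d + ι M * ι q) (ι d + ι N * ι b) * pow ζ d * pow (pow ζ N) b
        ∎
      where
      b = B M N q
      regroup : ∀ F z z' → F * (z * z') ≈ 1# * F * z * z'
      regroup = solve 3 (λ F z z' → F :* (z :* z') := con 1 :* F :* z :* z') refl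

    shiftedSum-suc : ∀ p ζ {k f} → Deg< k f →
      shiftedSum (suc p) ζ f ≈ shiftedSum p (pow ζ N) (Average.avg₁ M (ι M) (ι N) ζ f)
    shiftedSum-suc p ζ {f = f} df = begin
      sumTo (M ℕ.* M ^ p) term
        ≡⟨ cong (λ n → sumTo n term) (ℕₚ.*-comm M (M ^ p)) ⟩
      sumTo (M ^ p ℕ.* M) term
        ≈⟨ sumTo-blocks (M ^ p) M term ⟩
      sumTo (M ^ p) (λ q → sumTo M (λ d → term (d ℕ.+ q ℕ.* M)))
        ≈⟨ sumTo-cong (M ^ p) (λ {q} _ → digits q) ⟩
      shiftedSum p (pow ζ N) (avg₁ f)
        ∎
      where
      open Average M (ι M) (ι N) ζ using (avg₁)
      term : ℕ → Carrier
      term n = f (ι n) (ι (B M N n)) * pow ζ (B M N n)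
      digits : ∀ q → sumTo M (λ d → term (d ℕ.+ q ℕ.* M))
                       ≈ avg₁ f (ι q) (ι (B M N q)) * pow (pow ζ N) (B M N q)
      digits q = trans (sumTo-cong M (shiftedSum-digit ζ df q)) (sumTo-*ʳ M _ _)

    shiftedSum≈0 : ∀ p ζ → (∀ j → sumTo M (pow (pow ζ (N ^ j))) ≈ 0#) →
      ∀ {f} → Deg< p f → shiftedSum p ζ f ≈ 0#
    shiftedSum≈0 zero    ζ Σ≈0 df = trans (+-identityˡ _) (trans (*-congʳ (Deg<0⇒≈0 df _ _)) (zeroˡ _))
    shiftedSum≈0 (suc p) ζ Σ≈0 df = trans (shiftedSum-suc p ζ df)
      (shiftedSum≈0 p (pow ζ N) Σ'≈0 (Average.avg₁-Deg<-pred M (ι M) (ι N) ζ Σζ≈0 df))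
      where
      Σζ≈0 : sumTo M (pow ζ) ≈ 0#
      Σζ≈0 = trans (sumTo-cong M (λ {d} _ → pow-cong d (sym (*-identityʳ ζ)))) (Σ≈0 0)
      Σ'≈0 : ∀ j → sumTo M (pow (pow (pow ζ N) (N ^ j))) ≈ 0#
      Σ'≈0 j = trans (sumTo-cong M (λ {d} _ → pow-cong d (pow-* ζ N (N ^ j)))) (Σ≈0 (suc j))

proposition5p3 : ∀ {c ℓ : Level} (R : CommutativeRing c ℓ) →
    let open CommutativeRing R
        open RingDefs R
    in IsIntegralDomain → CharZero →
       (M N p : ℕ) → 2 ≤ M → 1 ≤ N → ¬ (rad M ∣ rad N) →
       (ξ : Carrier) → IsPrimitiveRoot M ξ → 1 ≤ p →
       (coef : ℕ → ℕ → Carrier) →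
       sumTo (M ^ p) (λ n → evalPoly p coef (ι n) (ι (B M N n)) * pow ξ (B M N n)) ≈ 0#
proposition5p3 R integral _ M N p 2≤M@(s≤s (s≤s _)) (s≤s _) rad∤ ξ ξ-primitive _ coef =
  shiftedSum≈0 p ξ (primitiveRoot-sumTo-pow-N^ integral ξ-primitive rad∤) (evalPoly-Deg< p coef)
  where
  open RingTheory R
  open ShiftedSum M N 2≤M
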